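{- Let $\mathcal{N}(P,E)$ be a ported (unoriented or oriented) matroid and fix a ported computation tree for it. For any leaf, the set of elements of $E$ that are internally active or internally passive with respect to that leaf is a $P$-subbasis of $\mathcal{N}$ (said to belong to the leaf). Moreover, every $P$-subbasis of $\mathcal{N}$ belongs to exactly one leaf.
   Context: A ported matroid (or oriented matroid) $\mathcal{N}(P,E)$ is a matroid (oriented matroid) on ground set $P\sqcup E$ with a distinguished set $P$ of ports. An element is non-separating if it is neither a loop nor a coloop. A $P$-subbasis of $\mathcal{N}$ is an independent set $F\subseteq E$ such that $F\cup P$ spans $\mathcal{N}$. A ported computation tree for $\mathcal{N}(P,E)$ is a rooted binary tree whose root is labeled $\mathcal{N}$ such that: if $\mathcal{N}$ has a non-separating element not in $P$, then for some such element $e$ the root has two subtrees, one a ported computation tree for $\mathcal{N}/e$ (the branch labeled "$e$ contracted") and the other a ported computation tree for $\mathcal{N}\setminus e$ (the branch labeled "$e$ deleted"), with ports $P$ in both; otherwise (every element outside $P$ is a loop or coloop) the root is a leaf. For a leaf and the path from the root to it: $e\in E$ labeled "contracted" along the path is internally passive; a coloop $e\in E$ of the leaf's matroid is internally active; $e\in E$ labeled "deleted" along the path is externally passive; a loop $e\in E$ of the leaf's matroid is externally active. -}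

module Defs where

open import Data.Nat using (ℕ; _<_)
open import Data.Fin using (Fin)
open import Data.Fin.Subset
  using (Subset; _∈_; _∉_; _⊆_; _∪_; ∁; ⁅_⁆; ∣_∣)
  renaming (⊥ to ∅)
open import Data.Product using (Σ; Σ-syntax; _×_; _,_)
open import Data.Sum using (_⊎_)
open import Relation.Nullary using (¬_; Dec)
open import Relation.Binary.PropositionalEquality using (_≡_)

-- Finite matroids on the ground set Fin n, via independent sets.
-- (An oriented matroid is treated through its underlying matroid: all
-- notions below -- independence, loops, coloops, minors, subbases --
-- only depend on the underlying matroid.)

record Matroid (n : ℕ) : Set₁ where
  field
    Indep      : Subset n → Set
    indep?     : (I : Subset n) → Dec (Indep I)
    indep-∅    : Indep ∅
    indep-⊆    : ∀ {I J} → J ⊆ I → Indep I → Indep J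
    indep-aug  : ∀ {I J} → Indep I → Indep J → ∣ I ∣ < ∣ J ∣ →
                 Σ[ x ∈ Fin n ] (x ∈ J × x ∉ I × Indep (⁅ x ⁆ ∪ I))

module _ {n : ℕ} (M : Matroid n) where
  open Matroid M

  BasisOf : Subset n → Subset n → Set
  BasisOf X B = B ⊆ X × Indep B ×
                (∀ x → x ∈ X → x ∉ B → ¬ Indep (⁅ x ⁆ ∪ B))

  Basis : Subset n → Set
  Basis B = Indep B × (∀ x → x ∉ B → ¬ Indep (⁅ x ⁆ ∪ B))

  Spans : Subset n → Set
  Spans X = Σ[ B ∈ Subset n ] (B ⊆ X × Basis B)

  -- The minor  M / C \ D  (C, D disjoint), with ground set ∁ (C ∪ D).

  Ground : Subset n → Subset n → Subset n
  Ground C D = ∁ (C ∪ D)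

  IndepMinor : Subset n → Subset n → Subset n → Set
  IndepMinor C D I = I ⊆ Ground C D ×
    Σ[ J ∈ Subset n ] (BasisOf C J × Indep (I ∪ J))

  BasisMinor : Subset n → Subset n → Subset n → Set
  BasisMinor C D B = IndepMinor C D B ×
    (∀ x → x ∈ Ground C D → x ∉ B → ¬ IndepMinor C D (⁅ x ⁆ ∪ B))

  LoopMinor : Subset n → Subset n → Fin n → Set
  LoopMinor C D e = e ∈ Ground C D × ¬ IndepMinor C D ⁅ e ⁆

  ColoopMinor : Subset n → Subset n → Fin n → Set
  ColoopMinor C D e = e ∈ Ground C D ×
    (∀ B → BasisMinor C D B → e ∈ B)

  module Ported (P : Subset n) where

    E : Subset n
    E = ∁ P

    PSubbasis : Subset n → Set
    PSubbasis F = F ⊆ E × Indep F × Spans (F ∪ P)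

    -- Ported computation tree for the minor N / C \ D (C = elements
    -- contracted so far, D = elements deleted so far).
    data Tree (C D : Subset n) : Set where
      leaf : (∀ e → e ∈ E → e ∈ Ground C D →
                LoopMinor C D e ⊎ ColoopMinor C D e) →
             Tree C D
      node : (e : Fin n) → e ∈ E → e ∈ Ground C D →
             ¬ LoopMinor C D e → ¬ ColoopMinor C D e →
             Tree (⁅ e ⁆ ∪ C) D →
             Tree C (⁅ e ⁆ ∪ D) →
             Tree C D

    -- Leaves of a tree, given by the root-to-leaf path.
    data Leaf : {C D : Subset n} → Tree C D → Set where
      here : ∀ {C D} {h : ∀ e → e ∈ E → e ∈ Ground C D →
                              LoopMinor C D e ⊎ ColoopMinor C D e} →
             Leaf (leaf {C} {D} h)
      contr : ∀ {C D e p q nl nc}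
                {tc : Tree (⁅ e ⁆ ∪ C) D} {td : Tree C (⁅ e ⁆ ∪ D)} →
              Leaf tc → Leaf (node e p q nl nc tc td)
      delet : ∀ {C D e p q nl nc}
                {tc : Tree (⁅ e ⁆ ∪ C) D} {td : Tree C (⁅ e ⁆ ∪ D)} →
              Leaf td → Leaf (node e p q nl nc tc td)

    leafC : ∀ {C D} {t : Tree C D} → Leaf t → Subset n
    leafC {C} here = C
    leafC (contr l) = leafC l
    leafC (delet l) = leafC l

    leafD : ∀ {C D} {t : Tree C D} → Leaf t → Subset n
    leafD {D = D} here = D
    leafD (contr l) = leafD l
    leafD (delet l) = leafD l

    InternallyPassive : ∀ {C D} {t : Tree C D} → Leaf t → Fin n → Set
    InternallyPassive l e = e ∈ E × e ∈ leafC l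

    InternallyActive : ∀ {C D} {t : Tree C D} → Leaf t → Fin n → Set
    InternallyActive l e = e ∈ E × ColoopMinor (leafC l) (leafD l) e

    BelongsTo : ∀ {C D} {t : Tree C D} → Subset n → Leaf t → Set
    BelongsTo F l = ∀ e → (e ∈ F → InternallyActive l e ⊎ InternallyPassive l e)
                        × (InternallyActive l e ⊎ InternallyPassive l e → e ∈ F)

{-# OPTIONS --safe #-}
-- Along every root-to-leaf path the contracted set C stays independent and
-- the complement of the deleted set D stays spanning: only non-loops are
-- contracted and only non-coloops deleted. At a leaf every remaining element
-- of E is a loop or a coloop of M / C \ D, so for any basis B of M with
-- C ⊆ B ⊆ ∁ D the internally active and passive elements are exactly B ∩ E,
-- which is a P-subbasis. Conversely a P-subbasis F is reached by contracting
-- the node elements lying in F and deleting the others; the branch taken at a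
-- node is forced by whether its element lies in F, whence uniqueness.
module Submission where

open import Defs
open import Data.Nat using (ℕ; _<_; _≤_)
open import Data.Nat.Properties using (≤-<-trans; ≮⇒≥; <⇒≱)
open import Data.Fin using (Fin)
open import Data.Fin.Subset
  using (Subset; _∈_; _∉_; _⊆_; _∪_; _∩_; ∁; ⁅_⁆; ∣_∣)
  renaming (⊥ to ∅)
open import Data.Fin.Subset.Properties
open import Data.List using (List; []; _∷_; allFin)
import Data.List.Relation.Unary.Any as Any
open import Data.List.Membership.Propositional using () renaming (_∈_ to _∈ₗ_)
open import Data.List.Membership.Propositional.Properties using (∈-allFin)
open import Data.Product using (Σ; Σ-syntax; _×_; _,_; proj₁; proj₂; map)
open import Data.Sum using (_⊎_; inj₁; inj₂; [_,_]′)
open import Data.Empty using (⊥; ⊥-elim)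
open import Function using (_∘_; id)
open import Relation.Nullary using (¬_; yes; no)
open import Relation.Nullary.Decidable using (_×-dec_; decidable-stable)
open import Relation.Binary.PropositionalEquality using (_≡_; refl; sym; cong; subst)

module _ {n : ℕ} where

  ∪-lub : ∀ {p q r : Subset n} → p ⊆ r → q ⊆ r → p ∪ q ⊆ r
  ∪-lub p⊆r q⊆r = [ p⊆r , q⊆r ]′ ∘ x∈p∪q⁻ _ _

  ∪-mono : ∀ {p p′ q q′ : Subset n} → p ⊆ p′ → q ⊆ q′ → p ∪ q ⊆ p′ ∪ q′
  ∪-mono {q′ = q′} p⊆p′ q⊆q′ = ∪-lub (p⊆p∪q q′ ∘ p⊆p′) (q⊆p∪q _ _ ∘ q⊆q′)

  ⁅x⁆⊆p : ∀ {x : Fin n} {p} → x ∈ p → ⁅ x ⁆ ⊆ p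
  ⁅x⁆⊆p {x} {p} x∈p y∈⁅x⁆ = subst (_∈ p) (sym (x∈⁅y⁆⇒x≡y x y∈⁅x⁆)) x∈p

  ∣p∣<∣⁅x⁆∪p∣ : ∀ {x : Fin n} {p} → x ∉ p → ∣ p ∣ < ∣ ⁅ x ⁆ ∪ p ∣
  ∣p∣<∣⁅x⁆∪p∣ {x} x∉p = p⊂q⇒∣p∣<∣q∣ (q⊆p∪q _ _ , x , p⊆p∪q _ (x∈⁅x⁆ x) , x∉p)

  p⊆p∩∁q∪q : ∀ (p q : Subset n) → p ⊆ (p ∩ ∁ q) ∪ q
  p⊆p∩∁q∪q p q {x} x∈p with x ∈? q
  ... | yes x∈q = q⊆p∪q _ q x∈q
  ... | no  x∉q = p⊆p∪q q (x∈p∩q⁺ (x∈p , x∉p⇒x∈∁p x∉q))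

  p⊆q∪r⇒p∩∁r⊆q : ∀ {p q r : Subset n} → p ⊆ q ∪ r → p ∩ ∁ r ⊆ q
  p⊆q∪r⇒p∩∁r⊆q {p} {q} {r} p⊆q∪r x∈p∩∁r with x∈p∩q⁻ p (∁ r) x∈p∩∁r
  ... | x∈p , x∈∁r = [ id , ⊥-elim ∘ x∈∁p⇒x∉p x∈∁r ]′ (x∈p∪q⁻ q r (p⊆q∪r x∈p))

  x∈∁∅ : ∀ {x : Fin n} → x ∈ ∁ ∅
  x∈∁∅ = x∉p⇒x∈∁p ∉⊥

  x∈∁p∪q⁺ : ∀ {p q : Subset n} {x} → x ∈ ∁ p → x ∈ ∁ q → x ∈ ∁ (p ∪ q)
  x∈∁p∪q⁺ x∈∁p x∈∁q =
    x∉p⇒x∈∁p ([ x∈∁p⇒x∉p x∈∁p , x∈∁p⇒x∉p x∈∁q ]′ ∘ x∈p∪q⁻ _ _)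

  ∁p∪q⊆∁p : ∀ (p q : Subset n) → ∁ (p ∪ q) ⊆ ∁ p
  ∁p∪q⊆∁p p q = p⊆q⇒∁p⊇∁q (p⊆p∪q q)

  ∁p∪q⊆∁q : ∀ (p q : Subset n) → ∁ (p ∪ q) ⊆ ∁ q
  ∁p∪q⊆∁q p q = p⊆q⇒∁p⊇∁q (q⊆p∪q p q)

  ⊆∁-sym : ∀ {p q : Subset n} → p ⊆ ∁ q → q ⊆ ∁ p
  ⊆∁-sym p⊆∁q x∈q = x∉p⇒x∈∁p (λ x∈p → x∈∁p⇒x∉p (p⊆∁q x∈p) x∈q)

  ⊆∁∪ : ∀ {p q r : Subset n} → p ⊆ ∁ q → p ⊆ ∁ r → p ⊆ ∁ (q ∪ r)
  ⊆∁∪ p⊆∁q p⊆∁r x∈p = x∈∁p∪q⁺ (p⊆∁q x∈p) (p⊆∁r x∈p)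

  ⁅x⁆∪p⊆∁q : ∀ {x : Fin n} {p q} → x ∈ ∁ (p ∪ q) → p ⊆ ∁ q → ⁅ x ⁆ ∪ p ⊆ ∁ q
  ⁅x⁆∪p⊆∁q {p = p} {q} x∈∁p∪q p⊆∁q = ∪-lub (⁅x⁆⊆p (∁p∪q⊆∁q p q x∈∁p∪q)) p⊆∁q

  p⊆∁⁅x⁆∪q : ∀ {x : Fin n} {p q} → x ∈ ∁ (p ∪ q) → p ⊆ ∁ q → p ⊆ ∁ (⁅ x ⁆ ∪ q)
  p⊆∁⁅x⁆∪q {p = p} {q} x∈∁p∪q p⊆∁q =
    ⊆∁∪ (⊆∁-sym (⁅x⁆⊆p (∁p∪q⊆∁p p q x∈∁p∪q))) p⊆∁q

module _ {n : ℕ} (M : Matroid n) where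
  open Matroid M

  private
    greedy : ∀ {X S} (xs : List (Fin n)) → S ⊆ X → Indep S →
             Σ[ B ∈ Subset n ] (S ⊆ B × B ⊆ X × Indep B ×
               (∀ {x} → x ∈ₗ xs → x ∈ X → x ∉ B → ¬ Indep (⁅ x ⁆ ∪ B)))
    greedy [] S⊆X iS = _ , ⊆-refl , S⊆X , iS , λ ()
    greedy {X} {S} (y ∷ xs) S⊆X iS with y ∈? X ×-dec indep? (⁅ y ⁆ ∪ S)
    ... | yes (y∈X , iyS) =
      let (B , yS⊆B , B⊆X , iB , sat) = greedy xs (∪-lub (⁅x⁆⊆p y∈X) S⊆X) iyS
      in B , ⊆-trans (q⊆p∪q _ _) yS⊆B , B⊆X , iB ,
         λ { (Any.here refl) _ y∉B _ → y∉B (yS⊆B (p⊆p∪q S (x∈⁅x⁆ y)))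
           ; (Any.there x∈xs) → sat x∈xs }
    ... | no ¬y∈X×iyS =
      let (B , S⊆B , B⊆X , iB , sat) = greedy xs S⊆X iS
      in B , S⊆B , B⊆X , iB ,
         λ { (Any.here refl) y∈X _ iyB →
               ¬y∈X×iyS (y∈X , indep-⊆ (∪-mono ⊆-refl S⊆B) iyB)
           ; (Any.there x∈xs) → sat x∈xs }

  extend-to-basisOf : ∀ {X S} → S ⊆ X → Indep S →
                      Σ[ B ∈ Subset n ] (S ⊆ B × BasisOf M X B)
  extend-to-basisOf S⊆X iS =
    let (B , S⊆B , B⊆X , iB , sat) = greedy (allFin n) S⊆X iS
    in B , S⊆B , B⊆X , iB , λ x → sat (∈-allFin x)

  ∣indep∣≤∣maximal∣ : ∀ {B I} → Indep B →
                      (∀ {y} → y ∈ I → y ∉ B → ¬ Indep (⁅ y ⁆ ∪ B)) →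
                      Indep I → ∣ I ∣ ≤ ∣ B ∣
  ∣indep∣≤∣maximal∣ iB maxB iI = ≮⇒≥ λ ∣B∣<∣I∣ →
    let (y , y∈I , y∉B , iyB) = indep-aug iB iI ∣B∣<∣I∣ in maxB y∈I y∉B iyB

  basisOf-spanning⇒basis : ∀ {X B} → Spans M X → BasisOf M X B → Basis M B
  basisOf-spanning⇒basis {B = B} (B₀ , B₀⊆X , iB₀ , maxB₀) (_ , iB , maxB) =
    iB , λ x x∉B ixB →
      <⇒≱ (≤-<-trans ∣B₀∣≤∣B∣ (∣p∣<∣⁅x⁆∪p∣ x∉B))
          (∣indep∣≤∣maximal∣ iB₀ (λ {y} _ → maxB₀ y) ixB)
    where
    ∣B₀∣≤∣B∣ : ∣ B₀ ∣ ≤ ∣ B ∣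
    ∣B₀∣≤∣B∣ = ∣indep∣≤∣maximal∣ iB (λ {y} y∈B₀ → maxB y (B₀⊆X y∈B₀)) iB₀

  spans-∁∅ : Spans M (∁ ∅)
  spans-∁∅ =
    let (B , _ , B⊆∁∅ , iB , maxB) = extend-to-basisOf (⊆-min (∁ ∅)) indep-∅
    in B , B⊆∁∅ , iB , λ x → maxB x x∈∁∅

  spans-stable : ∀ {X} → ¬ ¬ Spans M X → Spans M X
  spans-stable {X} ¬¬spans =
    let (B , _ , bo@(B⊆X , iB , _)) = extend-to-basisOf (⊆-min X) indep-∅
    in B , B⊆X , iB , λ x x∉B ixB → ¬¬spans λ spans →
         proj₂ (basisOf-spanning⇒basis spans bo) x x∉B ixB

  module _ {C : Subset n} (iC : Indep C) where

    basisOf-self : BasisOf M C C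
    basisOf-self = ⊆-refl , iC , λ _ x∈C x∉C _ → x∉C x∈C

    basisOf⊇ : ∀ {J} → BasisOf M C J → C ⊆ J
    basisOf⊇ {J} (J⊆C , _ , maxJ) {x} x∈C = decidable-stable (x ∈? J) λ x∉J →
      maxJ x x∈C x∉J (indep-⊆ (∪-lub (⁅x⁆⊆p x∈C) J⊆C) iC)

    indepMinor⇒indep : ∀ {D I} → IndepMinor M C D I → Indep (I ∪ C)
    indepMinor⇒indep (_ , J , bJ , iIJ) = indep-⊆ (∪-mono ⊆-refl (basisOf⊇ bJ)) iIJ

    indep⇒indepMinor : ∀ {D I} → I ⊆ Ground M C D → Indep (I ∪ C) → IndepMinor M C D I
    indep⇒indepMinor I⊆G iIC = I⊆G , C , basisOf-self , iIC

    ¬loop⇒indep : ∀ {D e} → e ∈ Ground M C D → ¬ LoopMinor M C D e → Indep (⁅ e ⁆ ∪ C)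
    ¬loop⇒indep e∈G ¬loop = decidable-stable (indep? _) λ ¬ieC →
      ¬loop (e∈G , ¬ieC ∘ indepMinor⇒indep)

    indep⇒¬loop : ∀ {D e} → Indep (⁅ e ⁆ ∪ C) → ¬ LoopMinor M C D e
    indep⇒¬loop ieC (e∈G , ¬ie) = ¬ie (indep⇒indepMinor (⁅x⁆⊆p e∈G) ieC)

    basisOf⇒basisMinor : ∀ {D B} → C ⊆ B → BasisOf M (∁ D) B →
                         BasisMinor M C D (B ∩ ∁ C)
    basisOf⇒basisMinor {D} {B} C⊆B (B⊆∁D , iB , maxB) =
      indep⇒indepMinor B∖C⊆G (indep-⊆ (∪-lub (p∩q⊆p B (∁ C)) C⊆B) iB) , maximal
      where
      B∖C⊆G : B ∩ ∁ C ⊆ Ground M C D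
      B∖C⊆G x∈B∖C =
        let (x∈B , x∈∁C) = x∈p∩q⁻ B (∁ C) x∈B∖C in x∈∁p∪q⁺ x∈∁C (B⊆∁D x∈B)
      maximal : ∀ x → x ∈ Ground M C D → x ∉ B ∩ ∁ C →
                ¬ IndepMinor M C D (⁅ x ⁆ ∪ (B ∩ ∁ C))
      maximal x x∈G x∉B∖C ind =
        maxB x (∁p∪q⊆∁q C D x∈G) x∉B (indep-⊆ ⁅x⁆∪B⊆ (indepMinor⇒indep ind))
        where
        x∉B : x ∉ B
        x∉B x∈B = x∉B∖C (x∈p∩q⁺ (x∈B , ∁p∪q⊆∁p C D x∈G))
        ⁅x⁆∪B⊆ : ⁅ x ⁆ ∪ B ⊆ (⁅ x ⁆ ∪ (B ∩ ∁ C)) ∪ C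
        ⁅x⁆∪B⊆ = ⊆-trans (∪-mono ⊆-refl (p⊆p∩∁q∪q B C))
                         (⊆-reflexive (sym (∪-assoc ⁅ x ⁆ (B ∩ ∁ C) C)))

    basisMinor⇒basisOf : ∀ {D B} → C ⊆ ∁ D → BasisMinor M C D B →
                         BasisOf M (∁ D) (B ∪ C)
    basisMinor⇒basisOf {D} {B} C⊆∁D (indB@(B⊆G , _) , maxB) =
      ∪-lub (⊆-trans B⊆G (∁p∪q⊆∁q C D)) C⊆∁D , indepMinor⇒indep indB , maximal
      where
      maximal : ∀ x → x ∈ ∁ D → x ∉ B ∪ C → ¬ Indep (⁅ x ⁆ ∪ (B ∪ C))
      maximal x x∈∁D x∉B∪C ixBC =
        maxB x x∈G (x∉B∪C ∘ p⊆p∪q C)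
          (indep⇒indepMinor (∪-lub (⁅x⁆⊆p x∈G) B⊆G)
            (indep-⊆ (⊆-reflexive (∪-assoc ⁅ x ⁆ B C)) ixBC))
        where
        x∈G : x ∈ Ground M C D
        x∈G = x∈∁p∪q⁺ (x∉p⇒x∈∁p (x∉B∪C ∘ q⊆p∪q B C)) x∈∁D

    coloop∈basisOf : ∀ {D B e} → C ⊆ B → BasisOf M (∁ D) B →
                     ColoopMinor M C D e → e ∈ B
    coloop∈basisOf {B = B} C⊆B bo (_ , inAllBases) =
      p∩q⊆p B (∁ C) (inAllBases _ (basisOf⇒basisMinor C⊆B bo))

    -- A basis of the minor avoiding e extends by C to a basis of M avoiding e.
    ¬coloop⇒spans : ∀ {D e} → C ⊆ ∁ D → Spans M (∁ D) → e ∈ Ground M C D →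
                    ¬ ColoopMinor M C D e → Spans M (∁ (⁅ e ⁆ ∪ D))
    ¬coloop⇒spans {D} {e} C⊆∁D spans e∈G ¬coloop = spans-stable λ ¬spans →
      ¬coloop (e∈G , λ B bm → decidable-stable (e ∈? B) λ e∉B →
        let bo@(B∪C⊆∁D , _) = basisMinor⇒basisOf C⊆∁D bm
            e∈∁B∪C = x∈∁p∪q⁺ (x∉p⇒x∈∁p e∉B) (∁p∪q⊆∁p C D e∈G)
        in ¬spans (B ∪ C , ⊆∁∪ (⊆∁-sym (⁅x⁆⊆p e∈∁B∪C)) B∪C⊆∁D ,
                   basisOf-spanning⇒basis spans bo))

module _ {n : ℕ} (M : Matroid n) (P : Subset n) where
  open Matroid M
  open Ported M P

  AllSeparating : Subset n → Subset n → Set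
  AllSeparating C D =
    ∀ e → e ∈ E → e ∈ Ground M C D → LoopMinor M C D e ⊎ ColoopMinor M C D e

  record Admissible (C D : Subset n) : Set where
    field
      C-indep  : Indep C
      C⊆E      : C ⊆ E
      C⊆∁D     : C ⊆ ∁ D
      ∁D-spans : Spans M (∁ D)

  admissible-∅ : Admissible ∅ ∅
  admissible-∅ = record
    { C-indep = indep-∅ ; C⊆E = ⊆-min E ; C⊆∁D = λ _ → x∈∁∅ ; ∁D-spans = spans-∁∅ M }

  admissible-contract : ∀ {C D e} → Admissible C D → e ∈ E → e ∈ Ground M C D →
                        ¬ LoopMinor M C D e → Admissible (⁅ e ⁆ ∪ C) D
  admissible-contract adm e∈E e∈G ¬loop = record
    { C-indep  = ¬loop⇒indep M C-indep e∈G ¬loop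
    ; C⊆E      = ∪-lub (⁅x⁆⊆p e∈E) C⊆E
    ; C⊆∁D     = ⁅x⁆∪p⊆∁q e∈G C⊆∁D
    ; ∁D-spans = ∁D-spans
    }
    where open Admissible adm

  admissible-delete : ∀ {C D e} → Admissible C D → e ∈ Ground M C D →
                      ¬ ColoopMinor M C D e → Admissible C (⁅ e ⁆ ∪ D)
  admissible-delete adm e∈G ¬coloop = record
    { C-indep  = C-indep
    ; C⊆E      = C⊆E
    ; C⊆∁D     = p⊆∁⁅x⁆∪q e∈G C⊆∁D
    ; ∁D-spans = ¬coloop⇒spans M C-indep C⊆∁D ∁D-spans e∈G ¬coloop
    }
    where open Admissible adm

  basis∩E-subbasis : ∀ {B} → Basis M B → PSubbasis (B ∩ E)
  basis∩E-subbasis {B} bB@(iB , _) =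
    p∩q⊆q B E , indep-⊆ (p∩q⊆p B E) iB , B , p⊆p∩∁q∪q B P , bB

  belongsTo-leaf : ∀ {C D B} (h : AllSeparating C D) → Basis M B → C ⊆ B → B ⊆ ∁ D →
                   C ⊆ E → BelongsTo (B ∩ E) (here {h = h})
  belongsTo-leaf {C} {B = B} h (iB , maxB) C⊆B B⊆∁D C⊆E e = ∈⇒active∪passive , active∪passive⇒∈
    where
    iC : Indep C
    iC = indep-⊆ C⊆B iB
    ∈⇒active∪passive : e ∈ B ∩ E →
      InternallyActive (here {h = h}) e ⊎ InternallyPassive (here {h = h}) e
    ∈⇒active∪passive e∈B∩E with x∈p∩q⁻ B E e∈B∩E | e ∈? C
    ... | _ ,  e∈E | yes e∈C = inj₂ (e∈E , e∈C)
    ... | e∈B , e∈E | no e∉C with h e e∈E (x∈∁p∪q⁺ (x∉p⇒x∈∁p e∉C) (B⊆∁D e∈B))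
    ...   | inj₁ loop   = ⊥-elim (indep⇒¬loop M iC (indep-⊆ (∪-lub (⁅x⁆⊆p e∈B) C⊆B) iB) loop)
    ...   | inj₂ coloop = inj₁ (e∈E , coloop)
    active∪passive⇒∈ : InternallyActive (here {h = h}) e ⊎ InternallyPassive (here {h = h}) e →
           e ∈ B ∩ E
    active∪passive⇒∈ (inj₁ (e∈E , coloop)) =
      x∈p∩q⁺ (coloop∈basisOf M iC C⊆B (B⊆∁D , iB , λ x _ → maxB x) coloop , e∈E)
    active∪passive⇒∈ (inj₂ (e∈E , e∈C)) = x∈p∩q⁺ (C⊆B e∈C , e∈E)

  leaf-subbasis : ∀ {C D} {t : Tree C D} → Admissible C D → (l : Leaf t) →
                  Σ[ F ∈ Subset n ] (BelongsTo F l × PSubbasis F)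
  leaf-subbasis adm (here {h = h}) =
    let (B , C⊆B , bo@(B⊆∁D , _)) = extend-to-basisOf M C⊆∁D C-indep
        bB = basisOf-spanning⇒basis M ∁D-spans bo
    in B ∩ E , belongsTo-leaf h bB C⊆B B⊆∁D C⊆E , basis∩E-subbasis bB
    where open Admissible adm
  leaf-subbasis adm (contr {p = e∈E} {q = e∈G} {nl = ¬loop} l) =
    leaf-subbasis (admissible-contract adm e∈E e∈G ¬loop) l
  leaf-subbasis adm (delet {q = e∈G} {nc = ¬coloop} l) =
    leaf-subbasis (admissible-delete adm e∈G ¬coloop) l

  module _ {F : Subset n} (F-subbasis : PSubbasis F) where

    belongsTo-leaf-subbasis : ∀ {C D} (h : AllSeparating C D) → C ⊆ F → F ⊆ ∁ D →
                              D ⊆ E → BelongsTo F (here {h = h})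
    belongsTo-leaf-subbasis h C⊆F F⊆∁D D⊆E =
      let (F⊆E , iF , spans) = F-subbasis
          (B , F⊆B , bo@(B⊆F∪P , _)) = extend-to-basisOf M (p⊆p∪q P) iF
          B∩E≡F = ⊆-antisym (p⊆q∪r⇒p∩∁r⊆q B⊆F∪P) (λ x∈F → x∈p∩q⁺ (F⊆B x∈F , F⊆E x∈F))
      in subst (λ G → BelongsTo G (here {h = h})) B∩E≡F
           (belongsTo-leaf h (basisOf-spanning⇒basis M spans bo) (⊆-trans C⊆F F⊆B)
              (⊆-trans B⊆F∪P (∪-lub F⊆∁D (⊆∁-sym D⊆E))) (⊆-trans C⊆F F⊆E))

    leaf-of-subbasis : ∀ {C D} (t : Tree C D) → C ⊆ F → F ⊆ ∁ D → D ⊆ E →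
                       Σ[ l ∈ Leaf t ] BelongsTo F l
    leaf-of-subbasis (leaf h) C⊆F F⊆∁D D⊆E = here , belongsTo-leaf-subbasis h C⊆F F⊆∁D D⊆E
    leaf-of-subbasis {D = D} (node e e∈E _ _ _ tc td) C⊆F F⊆∁D D⊆E with e ∈? F
    ... | yes e∈F = map contr id (leaf-of-subbasis tc (∪-lub (⁅x⁆⊆p e∈F) C⊆F) F⊆∁D D⊆E)
    ... | no  e∉F = map delet id (leaf-of-subbasis td C⊆F F⊆∁⁅e⁆∪D (∪-lub (⁅x⁆⊆p e∈E) D⊆E))
      where
      F⊆∁⁅e⁆∪D : F ⊆ ∁ (⁅ e ⁆ ∪ D)
      F⊆∁⁅e⁆∪D = ⊆∁∪ (⊆∁-sym (⁅x⁆⊆p (x∉p⇒x∈∁p e∉F))) F⊆∁D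

  leafC-⊇ : ∀ {C D} {t : Tree C D} (l : Leaf t) → C ⊆ leafC l
  leafC-⊇ here      = ⊆-refl
  leafC-⊇ (contr l) = ⊆-trans (q⊆p∪q _ _) (leafC-⊇ l)
  leafC-⊇ (delet l) = leafC-⊇ l

  leafD-⊇ : ∀ {C D} {t : Tree C D} (l : Leaf t) → D ⊆ leafD l
  leafD-⊇ here      = ⊆-refl
  leafD-⊇ (contr l) = leafD-⊇ l
  leafD-⊇ (delet l) = ⊆-trans (q⊆p∪q _ _) (leafD-⊇ l)

  leafC⊆∁leafD : ∀ {C D} {t : Tree C D} → C ⊆ ∁ D → (l : Leaf t) → leafC l ⊆ ∁ (leafD l)
  leafC⊆∁leafD C⊆∁D here = C⊆∁D
  leafC⊆∁leafD C⊆∁D (contr {q = e∈G} l) = leafC⊆∁leafD (⁅x⁆∪p⊆∁q e∈G C⊆∁D) l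
  leafC⊆∁leafD C⊆∁D (delet {q = e∈G} l) = leafC⊆∁leafD (p⊆∁⁅x⁆∪q e∈G C⊆∁D) l

  deleted∉ : ∀ {C D F e} {t : Tree C D} → C ⊆ ∁ D → (l : Leaf t) → BelongsTo F l →
             e ∈ leafD l → e ∉ F
  deleted∉ {e = e} C⊆∁D l belongs e∈D e∈F with proj₁ (belongs e) e∈F
  ... | inj₁ (_ , e∈G , _) = x∈∁p⇒x∉p (∁p∪q⊆∁q (leafC l) (leafD l) e∈G) e∈D
  ... | inj₂ (_ , e∈C)     = x∈∁p⇒x∉p (leafC⊆∁leafD C⊆∁D l e∈C) e∈D

  branches-disagree : ∀ {C D F e} {tc : Tree (⁅ e ⁆ ∪ C) D} {td : Tree C (⁅ e ⁆ ∪ D)} →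
    e ∈ E → e ∈ Ground M C D → C ⊆ ∁ D → (lc : Leaf tc) → (ld : Leaf td) →
    BelongsTo F lc → BelongsTo F ld → ⊥
  branches-disagree {e = e} e∈E e∈G C⊆∁D lc ld belongs-c belongs-d =
    deleted∉ (p⊆∁⁅x⁆∪q e∈G C⊆∁D) ld belongs-d (leafD-⊇ ld (p⊆p∪q _ (x∈⁅x⁆ e)))
      (proj₂ (belongs-c e) (inj₂ (e∈E , leafC-⊇ lc (p⊆p∪q _ (x∈⁅x⁆ e)))))

  leaf-unique : ∀ {C D F} {t : Tree C D} → C ⊆ ∁ D → (l l′ : Leaf t) →
                BelongsTo F l → BelongsTo F l′ → l ≡ l′
  leaf-unique _ here here _ _ = refl
  leaf-unique C⊆∁D (contr {q = e∈G} l) (contr l′) b b′ =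
    cong contr (leaf-unique (⁅x⁆∪p⊆∁q e∈G C⊆∁D) l l′ b b′)
  leaf-unique C⊆∁D (delet {q = e∈G} l) (delet l′) b b′ =
    cong delet (leaf-unique (p⊆∁⁅x⁆∪q e∈G C⊆∁D) l l′ b b′)
  leaf-unique C⊆∁D (contr {p = e∈E} {q = e∈G} l) (delet l′) b b′ =
    ⊥-elim (branches-disagree e∈E e∈G C⊆∁D l l′ b b′)
  leaf-unique C⊆∁D (delet {p = e∈E} {q = e∈G} l) (contr l′) b b′ =
    ⊥-elim (branches-disagree e∈E e∈G C⊆∁D l′ l b′ b)

proposition33 : ∀ {n : ℕ} (M : Matroid n) (P : Subset n)
    (t : Ported.Tree M P ∅ ∅) →
    ((l : Ported.Leaf M P t) →
       Σ[ F ∈ Subset n ] (Ported.BelongsTo M P F l × Ported.PSubbasis M P F))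
    × ((F : Subset n) → Ported.PSubbasis M P F →
       Σ[ l ∈ Ported.Leaf M P t ] (Ported.BelongsTo M P F l ×
         ((l′ : Ported.Leaf M P t) → Ported.BelongsTo M P F l′ → l′ ≡ l)))
proposition33 M P t =
  leaf-subbasis M P (admissible-∅ M P) ,
  λ F F-subbasis →
    let (l , belongs) = leaf-of-subbasis M P F-subbasis t (⊆-min F) (λ _ → x∈∁∅) (⊆-min _)
    in l , belongs , λ l′ belongs′ → leaf-unique M P (λ _ → x∈∁∅) l′ l belongs′ belongs
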